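{- Let $W$ be a finite set, let $a:W\to\mathbb{N}$ and $d:W\to\mathbb{N}$ be functions, and for $S\subseteq W$ put $C_S(q,t)=\sum_{w\in S}q^{a(w)}t^{d(w)}$. Let $I\subseteq W$ and $T\subseteq W$, and suppose $f:W\setminus T\to W\setminus I$ is a bijection such that $a(f(w))=a(w)-1$ and $d(f(w))=d(w)+1$ for all $w\in W\setminus T$. If $C_T(q,t)=C_I(t,q)$, then $C_W(q,t)=C_W(t,q)$.
   Context: Here $\mathbb{N}=\{0,1,2,\dots\}$ and $q,t$ are indeterminates. -}

module Defs where

open import Data.Nat using (ℕ; _≡ᵇ_)
open import Data.Bool using (Bool; true; false; _∧_; if_then_else_)
open import Data.Fin using (Fin)
open import Data.List using (map; allFin)
open import Data.Nat.ListAction using (sum)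
open import Relation.Binary.PropositionalEquality using (_≡_)

-- A polynomial in ℕ[q,t], represented by its coefficient function:
-- (coeff i j) is the coefficient of q^i t^j.
Poly₂ : Set
Poly₂ = ℕ → ℕ → ℕ

swapVars : Poly₂ → Poly₂
swapVars P i j = P j i

_≗₂_ : Poly₂ → Poly₂ → Set
P ≗₂ Q = ∀ i j → P i j ≡ Q i j

-- The finite set W is Fin n; subsets S ⊆ W are Boolean predicates.
-- C_S(q,t) = Σ_{w ∈ S} q^{a w} t^{d w}; its coefficient of q^i t^j
-- is the number of w ∈ S with a w = i and d w = j.
C : {n : ℕ} → (a d : Fin n → ℕ) → (S : Fin n → Bool) → Poly₂
C {n} a d S i j =
  sum (map (λ w → if S w ∧ (a w ≡ᵇ i) ∧ (d w ≡ᵇ j) then 1 else 0) (allFin n))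

full : {n : ℕ} → Fin n → Bool
full _ = true

-- Each w ∉ T is sent by f to f w ∉ I with one q fewer and one t more, so
-- t·C_{W∖T} = q·C_{W∖I}, that is t(C_W − C_T) = q(C_W − C_I), whence
-- (t − q)·C_W(q,t) = t·C_T(q,t) − q·C_I(q,t).  By C_T(q,t) = C_I(t,q) the right-hand
-- side changes sign under q ↔ t, so cancelling t − q shows that C_W is symmetric.
-- Over ℕ the cancellation becomes an induction on the q-degree of the coefficients,
-- starting from the coefficients of q⁰, to which W ∖ T contributes nothing.
module Submission where

open import Defs
open import Data.Nat using (ℕ; zero; suc; _+_; _≤_; _≡ᵇ_)
open import Data.Nat.Properties using (≤-antisym; +-suc; +-cancelʳ-≡; +-commutativeSemigroup)
open import Data.Bool using (Bool; true; false; not; _∧_; if_then_else_)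
open import Data.Bool.Properties using (∧-zeroʳ) renaming (_≟_ to _≟ᴮ_)
open import Data.Fin using (Fin; zero; suc)
open import Data.Fin.Properties using (injective⇒≤) renaming (suc-injective to Fin-suc-injective)
open import Data.Product using (Σ; _×_; _,_; proj₁; proj₂; uncurry)
open import Data.List using (map; allFin; tabulate)
open import Data.List.Properties using (map-tabulate)
open import Data.Nat.ListAction using (sum)
open import Function using (_∘_; id)
open import Function.Bundles using (_⤖_; Bijection; Surjection)
open import Function.Definitions using (Injective)
open import Relation.Binary.PropositionalEquality using (_≡_; refl; sym; trans; cong; cong₂; module ≡-Reasoning)
open import Axiom.UniquenessOfIdentityProofs using (module Decidable⇒UIP)
open import Algebra.Properties.CommutativeSemigroup +-commutativeSemigroup using (xy∙z≈x∙zy)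

private
  variable
    A : Set
    m n : ℕ

not∧≡true⇒ : ∀ {x y} → not x ∧ y ≡ true → x ≡ false × y ≡ true
not∧≡true⇒ {false} {true} refl = refl , refl

≡false⇒≡true⇒not∧≡true : ∀ {x y} → x ≡ false → y ≡ true → not x ∧ y ≡ true
≡false⇒≡true⇒not∧≡true refl refl = refl

subtype-≡ : {P : A → Bool} {b : Bool} {x y : Σ A (λ w → P w ≡ b)} → proj₁ x ≡ proj₁ y → x ≡ y
subtype-≡ {x = w , p} {y = .w , q} refl = cong (w ,_) (Decidable⇒UIP.≡-irrelevant _≟ᴮ_ p q)

count : (Fin n → Bool) → ℕ
count {zero} P = 0
count {suc n} P = (if P zero then 1 else 0) + count (λ w → P (suc w))

sum-indicator≡count : (P : Fin n → Bool) → sum (map (λ w → if P w then 1 else 0) (allFin n)) ≡ count P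
sum-indicator≡count P = trans (cong sum (map-tabulate id (λ w → if P w then 1 else 0))) (sum-tabulate P)
  where
  sum-tabulate : (P : Fin n → Bool) → sum (tabulate (λ w → if P w then 1 else 0)) ≡ count P
  sum-tabulate {zero} P = refl
  sum-tabulate {suc n} P = cong ((if P zero then 1 else 0) +_) (sum-tabulate (λ w → P (suc w)))

count-false : (P : Fin n → Bool) → (∀ w → P w ≡ false) → count P ≡ 0
count-false {zero} P P≡false = refl
count-false {suc n} P P≡false rewrite P≡false zero = count-false (λ w → P (suc w)) (P≡false ∘ suc)

count-partition : (S P : Fin n → Bool) → count P ≡ count (λ w → S w ∧ P w) + count (λ w → not (S w) ∧ P w)
count-partition {zero} S P = refl
count-partition {suc n} S P with S zero | P zero | count-partition (λ w → S (suc w)) (λ w → P (suc w))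
... | true  | true  | eq = cong suc eq
... | true  | false | eq = eq
... | false | true  | eq = trans (cong suc eq) (sym (+-suc _ _))
... | false | false | eq = eq

enum : (P : Fin n → Bool) → Fin (count P) → Fin n
enum {suc n} P i with P zero
enum {suc n} P zero    | true  = zero
enum {suc n} P (suc i) | true  = suc (enum (λ w → P (suc w)) i)
enum {suc n} P i       | false = suc (enum (λ w → P (suc w)) i)

enum-sound : (P : Fin n → Bool) (i : Fin (count P)) → P (enum P i) ≡ true
enum-sound {suc n} P i with P zero in eq
enum-sound {suc n} P zero    | true  = eq
enum-sound {suc n} P (suc i) | true  = enum-sound (λ w → P (suc w)) i
enum-sound {suc n} P i       | false = enum-sound (λ w → P (suc w)) i

enum-injective : (P : Fin n → Bool) → Injective _≡_ _≡_ (enum P)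
enum-injective {suc n} P {i} {j} e with P zero
enum-injective {suc n} P {zero}  {zero}  e  | true = refl
enum-injective {suc n} P {suc i} {suc j} e  | true =
  cong suc (enum-injective (λ w → P (suc w)) (Fin-suc-injective e))
enum-injective {suc n} P {i}     {j}     e  | false = enum-injective (λ w → P (suc w)) (Fin-suc-injective e)

enum-surjective : (P : Fin n → Bool) (w : Fin n) → P w ≡ true → Σ (Fin (count P)) (λ i → enum P i ≡ w)
enum-surjective {suc n} P w p with P zero in eq
enum-surjective {suc n} P zero    p | true  = zero , refl
enum-surjective {suc n} P (suc w) p | true  with i , e ← enum-surjective (λ w → P (suc w)) w p = suc i , cong suc e
enum-surjective {suc n} P (suc w) p | false with i , e ← enum-surjective (λ w → P (suc w)) w p = i , cong suc e
enum-surjective {suc n} P zero    p | false with () ← trans (sym eq) p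

index : (P : Fin n → Bool) (w : Fin n) → P w ≡ true → Fin (count P)
index P w p = proj₁ (enum-surjective P w p)

index-injective : (P : Fin n → Bool) → Injective _≡_ _≡_ (uncurry (index P))
index-injective P {w , p} {v , q} e = subtype-≡ (begin
  w                    ≡⟨ proj₂ (enum-surjective P w p) ⟨
  enum P (index P w p) ≡⟨ cong (enum P) e ⟩
  enum P (index P v q) ≡⟨ proj₂ (enum-surjective P v q) ⟩
  v                    ∎)
  where open ≡-Reasoning

count-mono : {P : Fin m → Bool} {Q : Fin n → Bool}
  (g : Σ (Fin m) (λ w → P w ≡ true) → Σ (Fin n) (λ v → Q v ≡ true)) → Injective _≡_ _≡_ g
  → count P ≤ count Q
count-mono {P = P} {Q} g g-injective = injective⇒≤ {f = h}
  (λ e → enum-injective P (cong proj₁ (g-injective (index-injective Q e))))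
  where
  h : Fin (count P) → Fin (count Q)
  h i = uncurry (index Q) (g (enum P i , enum-sound P i))

count-transport-≤ : {P R : Fin m → Bool} {Q S : Fin n → Bool}
  (g : Σ (Fin m) (λ w → P w ≡ false) → Σ (Fin n) (λ v → Q v ≡ false)) → Injective _≡_ _≡_ g
  → (∀ x → R (proj₁ x) ≡ S (proj₁ (g x)))
  → count (λ w → not (P w) ∧ R w) ≤ count (λ v → not (Q v) ∧ S v)
count-transport-≤ {P = P} {R} {Q} {S} g g-injective R≡S∘g = count-mono g′
  (λ e → subtype-≡ (cong proj₁ (g-injective (subtype-≡ (cong proj₁ e)))))
  where
  outside : Σ (Fin _) (λ w → not (P w) ∧ R w ≡ true) → Σ (Fin _) (λ w → P w ≡ false)
  outside x = proj₁ x , proj₁ (not∧≡true⇒ (proj₂ x))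
  g′ : Σ (Fin _) (λ w → not (P w) ∧ R w ≡ true) → Σ (Fin _) (λ v → not (Q v) ∧ S v ≡ true)
  g′ x = proj₁ (g (outside x)) , ≡false⇒≡true⇒not∧≡true (proj₂ (g (outside x)))
    (trans (sym (R≡S∘g (outside x))) (proj₂ (not∧≡true⇒ (proj₂ x))))

count-transport : {P R : Fin m → Bool} {Q S : Fin n → Bool}
  (f : Σ (Fin m) (λ w → P w ≡ false) ⤖ Σ (Fin n) (λ v → Q v ≡ false))
  → (∀ x → R (proj₁ x) ≡ S (proj₁ (Bijection.to f x)))
  → count (λ w → not (P w) ∧ R w) ≡ count (λ v → not (Q v) ∧ S v)
count-transport {R = R} {S = S} f R≡S∘f = ≤-antisym
  (count-transport-≤ to injective R≡S∘f)
  (count-transport-≤ to⁻ to⁻-injective S≡R∘to⁻)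
  where
  open Bijection f using (to; injective; surjection)
  open Surjection surjection using (to⁻; to∘to⁻)
  to⁻-injective : Injective _≡_ _≡_ to⁻
  to⁻-injective {x} {y} e = trans (sym (to∘to⁻ x)) (trans (cong to e) (to∘to⁻ y))
  S≡R∘to⁻ : ∀ y → S (proj₁ y) ≡ R (proj₁ (to⁻ y))
  S≡R∘to⁻ y = sym (trans (R≡S∘f (to⁻ y)) (cong (S ∘ proj₁) (to∘to⁻ y)))

-- X, T, I are the coefficient arrays of C_W, C_T, C_I; U and V those of C_{W∖T}, C_{W∖I}.
module CoefficientSymmetry
  (X T I U V : ℕ → ℕ → ℕ)
  (X≡T+U : ∀ i j → X i j ≡ T i j + U i j)
  (X≡I+V : ∀ i j → X i j ≡ I i j + V i j)
  (U-shift : ∀ i j → U (suc i) j ≡ V i (suc j))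
  (U-zero : ∀ j → U 0 j ≡ 0)
  (V-zero : ∀ i → V i 0 ≡ 0)
  (T≡Iᵀ : ∀ i j → T i j ≡ I j i)
  where
  open ≡-Reasoning

  X-symmetric : ∀ i j → X i j ≡ X j i
  X-symmetric zero j = begin
    X 0 j         ≡⟨ X≡T+U 0 j ⟩
    T 0 j + U 0 j ≡⟨ cong₂ _+_ (T≡Iᵀ 0 j) (trans (U-zero j) (sym (V-zero j))) ⟩
    I j 0 + V j 0 ≡⟨ X≡I+V j 0 ⟨
    X j 0         ∎
  X-symmetric (suc i) j = +-cancelʳ-≡ (I i (suc j)) _ _ (begin
    X (suc i) j + I i (suc j)                          ≡⟨ cong (_+ I i (suc j)) (X≡T+U (suc i) j) ⟩
    T (suc i) j + U (suc i) j + I i (suc j)            ≡⟨ cong (λ u → T (suc i) j + u + I i (suc j)) (U-shift i j) ⟩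
    T (suc i) j + V i (suc j) + I i (suc j)            ≡⟨ xy∙z≈x∙zy (T (suc i) j) _ _ ⟩
    T (suc i) j + (I i (suc j) + V i (suc j))          ≡⟨ cong (T (suc i) j +_) (X≡I+V i (suc j)) ⟨
    T (suc i) j + X i (suc j)                          ≡⟨ cong (T (suc i) j +_) (X-symmetric i (suc j)) ⟩
    T (suc i) j + X (suc j) i                          ≡⟨ cong (T (suc i) j +_) (X≡T+U (suc j) i) ⟩
    T (suc i) j + (T (suc j) i + U (suc j) i)          ≡⟨ cong (T (suc i) j +_) (cong₂ _+_ (T≡Iᵀ (suc j) i) (U-shift j i)) ⟩
    T (suc i) j + (I i (suc j) + V j (suc i))          ≡⟨ xy∙z≈x∙zy (T (suc i) j) _ _ ⟨
    T (suc i) j + V j (suc i) + I i (suc j)            ≡⟨ cong (λ t → t + V j (suc i) + I i (suc j)) (T≡Iᵀ (suc i) j) ⟩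
    I j (suc i) + V j (suc i) + I i (suc j)            ≡⟨ cong (_+ I i (suc j)) (X≡I+V j (suc i)) ⟨
    X j (suc i) + I i (suc j)                          ∎)

inBidegree : (a d : Fin n → ℕ) → ℕ → ℕ → Fin n → Bool
inBidegree a d i j w = (a w ≡ᵇ i) ∧ (d w ≡ᵇ j)

C≡count : (a d : Fin n → ℕ) (S : Fin n → Bool) (i j : ℕ)
  → C a d S i j ≡ count (λ w → S w ∧ inBidegree a d i j w)
C≡count a d S i j = sum-indicator≡count (λ w → S w ∧ inBidegree a d i j w)

theorem2p1 : (n : ℕ) (a d : Fin n → ℕ) (I T : Fin n → Bool)
    (f : Σ (Fin n) (λ w → T w ≡ false) ⤖ Σ (Fin n) (λ w → I w ≡ false))
    → (∀ w → suc (a (proj₁ (Bijection.to f w))) ≡ a (proj₁ w))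
    → (∀ w → d (proj₁ (Bijection.to f w)) ≡ suc (d (proj₁ w)))
    → C a d T ≗₂ swapVars (C a d I)
    → C a d full ≗₂ swapVars (C a d full)
theorem2p1 n a d I T f a-drop d-rise C-T≡C-Iᵀ i j = begin
  C a d full i j  ≡⟨ C≡count a d full i j ⟩
  count (E i j)   ≡⟨ X-symmetric i j ⟩
  count (E j i)   ≡⟨ C≡count a d full j i ⟨
  C a d full j i  ∎
  where
  open ≡-Reasoning
  E : ℕ → ℕ → Fin n → Bool
  E = inBidegree a d

  complement-shift : ∀ i j → count (λ w → not (T w) ∧ E (suc i) j w) ≡ count (λ w → not (I w) ∧ E i (suc j) w)
  complement-shift i j = count-transport f λ x →
    cong₂ _∧_ (cong (_≡ᵇ suc i) (sym (a-drop x))) (cong (_≡ᵇ suc j) (sym (d-rise x)))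

  complement-T-a≡0 : ∀ j → count (λ w → not (T w) ∧ E 0 j w) ≡ 0
  complement-T-a≡0 j = trans
    (count-transport f λ x → cong (λ k → (k ≡ᵇ 0) ∧ _) (sym (a-drop x)))
    (count-false _ (λ v → ∧-zeroʳ (not (I v))))

  complement-I-d≡0 : ∀ i → count (λ w → not (I w) ∧ E i 0 w) ≡ 0
  complement-I-d≡0 i = trans
    (sym (count-transport f λ x → sym (trans (cong (λ k → _ ∧ (k ≡ᵇ 0)) (d-rise x)) (∧-zeroʳ _))))
    (count-false _ (λ w → ∧-zeroʳ (not (T w))))

  open CoefficientSymmetry
    (λ i j → count (E i j))
    (λ i j → count (λ w → T w ∧ E i j w)) (λ i j → count (λ w → I w ∧ E i j w))
    (λ i j → count (λ w → not (T w) ∧ E i j w)) (λ i j → count (λ w → not (I w) ∧ E i j w))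
    (λ i j → count-partition T (E i j)) (λ i j → count-partition I (E i j))
    complement-shift complement-T-a≡0 complement-I-d≡0
    (λ i j → trans (sym (C≡count a d T i j)) (trans (C-T≡C-Iᵀ i j) (C≡count a d I j i)))
    using (X-symmetric)
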